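{- Let $\mathcal{C}$ be a collection of itemsets over items $A=\{a_1,\dots,a_N\}$ and let $\mathcal{G}\subseteq\mathcal{C}$. Then $\mathcal{G}=\mathrm{closure}(\mathcal{G})$ if and only if there exists a block $T\in\mathcal{T}_{\mathcal{C}}$ such that $\mathcal{G}=\mathrm{sets}(T;\mathcal{C})$.
   Context: $\mathcal{T}=\{0,1\}^N$; for an itemset $X\subseteq A$, $S_X(t)=1$ iff $t_i=1$ for all $a_i\in X$. The collection $\mathcal{C}$ partitions $\mathcal{T}$ into blocks: $t_1,t_2$ lie in the same block iff $S_X(t_1)=S_X(t_2)$ for all $X\in\mathcal{C}$; $\mathcal{T}_{\mathcal{C}}$ denotes this partition, and $S_X(T)$ the common value of $S_X$ on block $T$. For a block $T$, $\mathrm{sets}(T;\mathcal{C})=\{X\in\mathcal{C}: S_X(T)=1\}$. For $\mathcal{G}\subseteq\mathcal{C}$, $\mathrm{closure}(\mathcal{G})=\{X\in\mathcal{C}: X\subseteq\bigcup_{Y\in\mathcal{G}}Y\}$. -}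

module Defs where

open import Data.Nat using (ℕ)
open import Data.Bool using (Bool; true; false; not; _∧_; _∨_)
open import Data.Vec using (Vec; []; _∷_)
open import Data.List using (List)
open import Data.Product using (Σ; ∃; _×_)
open import Function.Bundles using (_⇔_)
open import Relation.Binary.PropositionalEquality using (_≡_)
open import Data.Fin.Subset using (Subset; _⊆_; ⋃)
open import Data.List.Membership.Propositional renaming (_∈_ to _∈L_)

-- Items a_1..a_N are Fin N; an itemset X ⊆ A is a Subset N (Vec Bool N).
-- A transaction t ∈ {0,1}^N is a Vec Bool N.
Transaction : ℕ → Set
Transaction N = Vec Bool N

Collection : ℕ → Set
Collection N = List (Subset N)

S : ∀ {N} → Subset N → Transaction N → Bool
S [] [] = true
S (x ∷ X) (b ∷ t) = (not x ∨ b) ∧ S X t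

SameBlock : ∀ {N} → Collection N → Transaction N → Transaction N → Set
SameBlock C t₁ t₂ = ∀ X → X ∈L C → S X t₁ ≡ S X t₂

IsBlock : ∀ {N} → Collection N → (Transaction N → Set) → Set
IsBlock {N} C T = ∃ λ (t : Transaction N) → ∀ u → T u ⇔ SameBlock C t u

SOnBlock : ∀ {N} → Subset N → (Transaction N → Set) → Set
SOnBlock X T = ∀ t → T t → S X t ≡ true

sets : ∀ {N} → (Transaction N → Set) → Collection N → Subset N → Set
sets T C X = X ∈L C × SOnBlock X T

closure : ∀ {N} → Collection N → Collection N → Subset N → Set
closure C G X = X ∈L C × X ⊆ ⋃ G

_⊆C_ : ∀ {N} → Collection N → Collection N → Set
G ⊆C C = ∀ X → X ∈L G → X ∈L C

_≐_ : ∀ {N} → Collection N → (Subset N → Set) → Set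
G ≐ P = ∀ X → (X ∈L G ⇔ P X)

{-# OPTIONS --safe #-}
module Submission where

open import Defs
open import Data.Nat using (ℕ)
open import Data.Bool using (true; false)
open import Data.Product using (Σ-syntax; _×_; _,_; proj₂)
open import Data.Sum using ([_,_])
open import Data.Vec using ([]; _∷_)
open import Data.List using ([]; _∷_)
open import Data.List.Relation.Unary.Any using (here; there)
open import Data.List.Membership.Propositional renaming (_∈_ to _∈L_)
open import Data.Fin.Subset using (Subset; _⊆_; _∪_; ⋃)
open import Data.Fin.Subset.Properties using (⊆-trans; p⊆p∪q; q⊆p∪q; x∈p∪q⁻; ⊥⊆)
open import Function.Base using (id)
open import Function.Bundles using (_⇔_; mk⇔; Equivalence)
open import Function.Properties.Equivalence using () renaming (trans to ⇔-trans; sym to ⇔-sym)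
open import Relation.Binary.PropositionalEquality using (_≡_; refl; sym; trans)
import Data.Vec as Vec

open Equivalence

-- A block of T_C is determined by any of its transactions t, and S_X(t) = 1
-- says exactly that X ⊆ t when t is read as a set of items.  So sets(T;C) is
-- the down-set {X ∈ C : X ⊆ t}.  If G is closed, G = sets(T;C) for the block
-- of t = ⋃ G; conversely, G = {X ∈ C : X ⊆ t} forces ⋃ G ⊆ t, so
-- closure(G) ⊆ G.

S≡true⇒⊆ : ∀ {N} (X t : Subset N) → S X t ≡ true → X ⊆ t
S≡true⇒⊆ (true  ∷ X) (true ∷ t) eq Vec.here      = Vec.here
S≡true⇒⊆ (true  ∷ X) (true ∷ t) eq (Vec.there p) = Vec.there (S≡true⇒⊆ X t eq p)
S≡true⇒⊆ (false ∷ X) (b    ∷ t) eq (Vec.there p) = Vec.there (S≡true⇒⊆ X t eq p)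
S≡true⇒⊆ (true  ∷ X) (false ∷ t) () _

∷-⊆⁻ : ∀ {N} {x b} {X t : Subset N} → x ∷ X ⊆ b ∷ t → X ⊆ t
∷-⊆⁻ X⊆t p with X⊆t (Vec.there p)
... | Vec.there q = q

⊆⇒S≡true : ∀ {N} (X t : Subset N) → X ⊆ t → S X t ≡ true
⊆⇒S≡true []          []      _   = refl
⊆⇒S≡true (false ∷ X) (b ∷ t) X⊆t = ⊆⇒S≡true X t (∷-⊆⁻ X⊆t)
⊆⇒S≡true (true  ∷ X) (b ∷ t) X⊆t with X⊆t Vec.here
... | Vec.here = ⊆⇒S≡true X t (∷-⊆⁻ X⊆t)

⊆-⋃ : ∀ {N} {Y : Subset N} (G : Collection N) → Y ∈L G → Y ⊆ ⋃ G
⊆-⋃ (Z ∷ G) (here refl) = p⊆p∪q (⋃ G)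
⊆-⋃ (Z ∷ G) (there Y∈G) = ⊆-trans (⊆-⋃ G Y∈G) (q⊆p∪q Z (⋃ G))

∪-least : ∀ {N} {p q r : Subset N} → p ⊆ r → q ⊆ r → p ∪ q ⊆ r
∪-least {p = p} {q} p⊆r q⊆r x∈p∪q = [ p⊆r , q⊆r ] (x∈p∪q⁻ p q x∈p∪q)

⋃-least : ∀ {N} {t : Subset N} (G : Collection N) → (∀ {Y} → Y ∈L G → Y ⊆ t) → ⋃ G ⊆ t
⋃-least []      _   = ⊥⊆
⋃-least (Z ∷ G) G⊆t = ∪-least (G⊆t (here refl)) (⋃-least G (λ Y∈G → G⊆t (there Y∈G)))

blockOf : ∀ {N} → Collection N → Transaction N → Transaction N → Set
blockOf C t = SameBlock C t

blockOf-isBlock : ∀ {N} (C : Collection N) (t : Transaction N) → IsBlock C (blockOf C t)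
blockOf-isBlock C t = t , λ u → mk⇔ id id

sets-block⇔ : ∀ {N} {C : Collection N} {T : Transaction N → Set} →
              ((t , _) : IsBlock C T) → ∀ X → sets T C X ⇔ (X ∈L C × X ⊆ t)
sets-block⇔ (t , T⇔t) X = mk⇔
  (λ (X∈C , S₁) → X∈C , S≡true⇒⊆ X t (S₁ t (from (T⇔t t) (λ _ _ → refl))))
  (λ (X∈C , X⊆t) → X∈C , λ u Tu →
     trans (sym (to (T⇔t u) Tu X X∈C)) (⊆⇒S≡true X t X⊆t))

lemma4p16 : ∀ {N : ℕ} (C G : Collection N) → G ⊆C C →
    (G ≐ closure C G) ⇔ (Σ[ T ∈ (Transaction N → Set) ] (IsBlock C T × (G ≐ sets T C)))
lemma4p16 {N} C G G⊆C = mk⇔ closed⇒sets sets⇒closed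
  where
  closed⇒sets : G ≐ closure C G → Σ[ T ∈ (Transaction N → Set) ] (IsBlock C T × (G ≐ sets T C))
  closed⇒sets G≐cl = blockOf C (⋃ G) , block , λ X → ⇔-trans (G≐cl X) (⇔-sym (sets-block⇔ block X))
    where block = blockOf-isBlock C (⋃ G)

  sets⇒closed : Σ[ T ∈ (Transaction N → Set) ] (IsBlock C T × (G ≐ sets T C)) → G ≐ closure C G
  sets⇒closed (T , block@(t , _) , G≐sets) X = mk⇔ G⊆closure closure⊆G
    where
    G≐down : ∀ Y → Y ∈L G ⇔ (Y ∈L C × Y ⊆ t)
    G≐down Y = ⇔-trans (G≐sets Y) (sets-block⇔ block Y)

    ⋃G⊆t : ⋃ G ⊆ t
    ⋃G⊆t = ⋃-least G λ Y∈G → proj₂ (to (G≐down _) Y∈G)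

    G⊆closure : X ∈L G → closure C G X
    G⊆closure X∈G = G⊆C X X∈G , ⊆-⋃ G X∈G

    closure⊆G : closure C G X → X ∈L G
    closure⊆G (X∈C , X⊆⋃G) = from (G≐down X) (X∈C , ⊆-trans X⊆⋃G ⋃G⊆t)
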